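{- Let $h:\mathbb{Z}_{\ge0}\to\mathbb{Z}_{\ge0}$ be nondecreasing and satisfy condition (a): for all $z,z'\in\mathbb{Z}_{\ge0}$ and every positive integer $i$, if $\lfloor z/2^i\rfloor=\lfloor z'/2^i\rfloor$ then $\lfloor h(z)/2^{i-1}\rfloor=\lfloor h(z')/2^{i-1}\rfloor$. Let $s$ be a positive integer such that $i\oplus s=i+s$ for $i=0,1,2,\dots,h(s)$, and let $h_s(z)=h(z+s)$ for all $z\in\mathbb{Z}_{\ge0}$. Then $G_{h_s}(\{y,z\})=(y\oplus(z+s))-s$ for all $y,z\in\mathbb{Z}_{\ge0}$ with $y\le h_s(z)$.
   Context: $\oplus$ denotes nim-sum (bitwise XOR). For a nondecreasing $f:\mathbb{Z}_{\ge0}\to\mathbb{Z}_{\ge0}$, positions of the chocolate bar game $CB(f,y,z)$ are pairs $\{y,z\}$ with $y\le f(z)$ (bar with $z+1$ columns, column 0 bitter, column $i$ of height $\min(f(i),y)+1$). Moves: $move_f(\{y,z\})=\{\{v,z\}:v<y\}\cup\{\{\min(y,f(w)),w\}:w<z\}$. Grundy number: $G_f(\{y,z\})=\mathrm{mex}\{G_f(p):p\in move_f(\{y,z\})\}$, mex being the least nonnegative integer not in the set. -}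

module Defs where

open import Data.Nat using (ℕ; zero; suc; _+_; _*_; _∸_; _^_; _≤_; _⊓_; _≡ᵇ_)
open import Data.Nat.DivMod using (_/_; _%_)
open import Data.Nat.Properties using (m^n≢0)
open import Relation.Binary.PropositionalEquality using (_≡_)
open import Data.Bool using (Bool; true; false; if_then_else_)
open import Data.List using (List; []; _∷_; map; upTo; _++_; length)
open import Data.Bool.ListAction using (any)

_/2^_ : ℕ → ℕ → ℕ
m /2^ i = _/_ m (2 ^ i) {{m^n≢0 2 i}}

bit : ℕ → ℕ → ℕ
bit i m = (m /2^ i) % 2

bitXor : ℕ → ℕ → ℕ
bitXor a b = if a ≡ᵇ b then 0 else 1

-- nim-sum (bitwise XOR): m ⊕ n = Σ_{i < m+n} 2^i * (bit_i m XOR bit_i n).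
-- (m, n < 2^(m+n), so all higher bits are 0.)
xorUpTo : ℕ → ℕ → ℕ → ℕ
xorUpTo zero    m n = 0
xorUpTo (suc k) m n = xorUpTo k m n + 2 ^ k * bitXor (bit k m) (bit k n)

infixl 6 _⊕_
_⊕_ : ℕ → ℕ → ℕ
m ⊕ n = xorUpTo (m + n) m n

elem : ℕ → List ℕ → Bool
elem k xs = any (λ x → k ≡ᵇ x) xs

-- mex: least natural number not in the list (searched among 0..length xs,
-- which always contains the mex)
mexFrom : ℕ → ℕ → List ℕ → ℕ
mexFrom zero    k xs = k
mexFrom (suc n) k xs = if elem k xs then mexFrom n (suc k) xs else k

mex : List ℕ → ℕ
mex xs = mexFrom (length xs) 0 xs

-- Grundy numbers of CB(f), computed with fuel. Every move from {y,z}
-- strictly decreases y + z, so fuel y + z + 1 suffices.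
-- Option list: {v,z} for v < y, and {min(y, f w), w} for w < z.
grundyFuel : ℕ → (ℕ → ℕ) → ℕ → ℕ → ℕ
grundyFuel zero    f y z = 0
grundyFuel (suc n) f y z =
  mex (map (λ v → grundyFuel n f v z) (upTo y)
       ++ map (λ w → grundyFuel n f (y ⊓ f w) w) (upTo z))

G : (ℕ → ℕ) → ℕ → ℕ → ℕ
G f y z = grundyFuel (suc (y + z)) f y z

Nondecreasing : (ℕ → ℕ) → Set
Nondecreasing h = ∀ a b → a ≤ b → h a ≤ h b

-- condition (a), with i = suc j ranging over positive integers
ConditionA : (ℕ → ℕ) → Set
ConditionA h = ∀ z z' j → z /2^ (suc j) ≡ z' /2^ (suc j) → h z /2^ j ≡ h z' /2^ j

-- Write Z = z + s. The options of {y, z} have values (v ⊕ Z) ∸ s for v < y and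
-- ((y ⊓ h W) ⊕ W) ∸ s for s ≤ W < Z, so it suffices that these avoid y ⊕ Z and attain every
-- K with s ≤ K < y ⊕ Z. Everything is decided at a highest differing bit i, where condition (a)
-- says that h W >> i depends only on W >> (i + 1). If W < Z split at bit i and h W < y, this
-- gives y >> i ≤ h W >> i, so h W and y agree at bit i while W and Z do not. If K splits from
-- y ⊕ Z at a bit set in y, then K = v ⊕ Z with v < y; if the bit is set in Z, then
-- W ↦ (y ⊓ h W) ⊕ W maps the block of numbers agreeing with Z above bit i onto a block
-- containing K. The hypothesis on s says that h s < 2 ^ k for the lowest set bit k of s; this
-- keeps y ⊕ Z ≥ s, so that ∸ s is exact, and the W found above ≥ s.

module Submission where

open import Defs
open import Data.Nat
  using (ℕ; zero; suc; _+_; _*_; _∸_; _^_; _≤_; _<_; _⊓_; _≟_; ⌊_/2⌋; parity; z≤n; s≤s; z<s; NonZero)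
open import Data.Nat.Properties
open import Data.Nat.DivMod using (_/_; _%_; [m+n]%n≡m%n; m/n≡1+[m∸n]/n; n/1≡n; m/n/o≡m/[n*o]; /-congʳ)
open import Data.Nat.Tactic.RingSolver using (solve-∀)
open import Data.Parity.Base using (Parity; 0ℙ; 1ℙ)
import Data.Parity.Base as ℙ
import Data.Parity.Properties as ℙ
open import Data.Product using (∃-syntax; _×_; _,_; proj₁; proj₂)
open import Data.Sum using (_⊎_; inj₁; inj₂)
open import Relation.Binary.PropositionalEquality
open import Relation.Nullary using (¬_; yes; no; contradiction)
open import Data.Bool using (true; false; T)
open import Data.List using (List; map; upTo; _++_; length)
open import Data.List.Properties using (length-++; length-map; length-upTo; map-cong-local)
import Data.List.Relation.Unary.All as All
open import Data.List.Relation.Unary.All.Properties using (all-upTo)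
import Data.List.Relation.Unary.Any as Any
open import Data.List.Relation.Unary.Any.Properties using (any⁺; any⁻)
open import Data.List.Membership.Propositional using (_∈_; _∉_)
open import Data.List.Membership.Propositional.Properties
  using (∈-map⁺; ∈-map⁻; ∈-++⁺ˡ; ∈-++⁺ʳ; ∈-++⁻; ∈-upTo⁺; ∈-upTo⁻)
open import Function using (_∘_)
open import Data.Nat.Induction using (<-rec)

-- Binary digits

toℕ : Parity → ℕ
toℕ 0ℙ = 0
toℕ 1ℙ = 1

toℕ-+ : ∀ p q → bitXor (toℕ p) (toℕ q) ≡ toℕ (p ℙ.+ q)
toℕ-+ 0ℙ 0ℙ = refl
toℕ-+ 0ℙ 1ℙ = refl
toℕ-+ 1ℙ 0ℙ = refl
toℕ-+ 1ℙ 1ℙ = refl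

private
  +2*-suc : ∀ a m → a + 2 * suc m ≡ 2 + (a + 2 * m)
  +2*-suc = solve-∀

+≡1ℙ-cases : ∀ {p q} → p ℙ.+ q ≡ 1ℙ → (p ≡ 1ℙ × q ≡ 0ℙ) ⊎ (p ≡ 0ℙ × q ≡ 1ℙ)
+≡1ℙ-cases {0ℙ} {1ℙ} _ = inj₂ (refl , refl)
+≡1ℙ-cases {1ℙ} {0ℙ} _ = inj₁ (refl , refl)

parity+2*⌊/2⌋ : ∀ n → toℕ (parity n) + 2 * ⌊ n /2⌋ ≡ n
parity+2*⌊/2⌋ 0             = refl
parity+2*⌊/2⌋ 1             = refl
parity+2*⌊/2⌋ (suc (suc n)) =
  trans (+2*-suc (toℕ (parity n)) ⌊ n /2⌋) (cong (2 +_) (parity+2*⌊/2⌋ n))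

parity-+2* : ∀ p m → parity (toℕ p + 2 * m) ≡ p
parity-+2* 0ℙ zero    = refl
parity-+2* 1ℙ zero    = refl
parity-+2* p  (suc m) rewrite +2*-suc (toℕ p) m = parity-+2* p m

⌊+2*/2⌋ : ∀ p m → ⌊ toℕ p + 2 * m /2⌋ ≡ m
⌊+2*/2⌋ 0ℙ zero    = refl
⌊+2*/2⌋ 1ℙ zero    = refl
⌊+2*/2⌋ p  (suc m) rewrite +2*-suc (toℕ p) m = cong suc (⌊+2*/2⌋ p m)

parity∧⌊/2⌋⇒≡ : ∀ {m n} → parity m ≡ parity n → ⌊ m /2⌋ ≡ ⌊ n /2⌋ → m ≡ n
parity∧⌊/2⌋⇒≡ {m} {n} p≡ h≡ = begin
  m                                 ≡⟨ parity+2*⌊/2⌋ m ⟨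
  toℕ (parity m) + 2 * ⌊ m /2⌋      ≡⟨ cong₂ (λ p q → toℕ p + 2 * q) p≡ h≡ ⟩
  toℕ (parity n) + 2 * ⌊ n /2⌋      ≡⟨ parity+2*⌊/2⌋ n ⟩
  n                                 ∎
  where open ≡-Reasoning

2*⌊n/2⌋≤n : ∀ n → 2 * ⌊ n /2⌋ ≤ n
2*⌊n/2⌋≤n n = subst (2 * ⌊ n /2⌋ ≤_) (parity+2*⌊/2⌋ n) (m≤n+m (2 * ⌊ n /2⌋) (toℕ (parity n)))

⌊n/2⌋≤n∸1 : ∀ n → ⌊ n /2⌋ ≤ n ∸ 1
⌊n/2⌋≤n∸1 0             = z≤n
⌊n/2⌋≤n∸1 1             = z≤n
⌊n/2⌋≤n∸1 (suc (suc n)) = s≤s (⌊n/2⌋≤n n)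

binary-ind₂ : (P : ℕ → ℕ → Set) → P 0 0 → (∀ x y → P ⌊ x /2⌋ ⌊ y /2⌋ → P x y) → ∀ x y → P x y
binary-ind₂ P base step x y = go (x + y) x y (m≤m+n x y) (m≤n+m y x)
  where
  go : ∀ n x y → x ≤ n → y ≤ n → P x y
  go zero    zero zero _   _   = base
  go (suc n) x    y    x≤n y≤n = step x y (go n ⌊ x /2⌋ ⌊ y /2⌋ (halve x≤n) (halve y≤n))
    where
    halve : ∀ {x} → x ≤ suc n → ⌊ x /2⌋ ≤ n
    halve {x} x≤ = ≤-trans (⌊n/2⌋≤n∸1 x) (∸-monoˡ-≤ 1 x≤)

infixl 8 _>>_
_>>_ : ℕ → ℕ → ℕ
x >> zero  = x
x >> suc j = ⌊ x >> j /2⌋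

⌊/2⌋>> : ∀ x j → ⌊ x /2⌋ >> j ≡ x >> suc j
⌊/2⌋>> x zero    = refl
⌊/2⌋>> x (suc j) = cong ⌊_/2⌋ (⌊/2⌋>> x j)

>>-+ : ∀ x i j → x >> (i + j) ≡ x >> i >> j
>>-+ x i zero    = cong (x >>_) (+-identityʳ i)
>>-+ x i (suc j) = trans (cong (x >>_) (+-suc i j)) (cong ⌊_/2⌋ (>>-+ x i j))

0>> : ∀ j → 0 >> j ≡ 0
0>> zero    = refl
0>> (suc j) = cong ⌊_/2⌋ (0>> j)

>>-mono-≤ : ∀ j {x y} → x ≤ y → x >> j ≤ y >> j
>>-mono-≤ zero    x≤y = x≤y
>>-mono-≤ (suc j) x≤y = ⌊n/2⌋-mono (>>-mono-≤ j x≤y)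

>>-cancel-< : ∀ j {x y} → x >> j < y >> j → x < y
>>-cancel-< j {x} {y} x>>j<y>>j = ≰⇒> (λ y≤x → <⇒≱ x>>j<y>>j (>>-mono-≤ j y≤x))

>>-distrib-⊓ : ∀ j x y → (x ⊓ y) >> j ≡ x >> j ⊓ y >> j
>>-distrib-⊓ j = mono-≤-distrib-⊓ (>>-mono-≤ j)

m≤n⇒m>>n≡0 : ∀ {x} j → x ≤ j → x >> j ≡ 0
m≤n⇒m>>n≡0 {x} j x≤j = n≤0⇒n≡0 (≤-trans (>>≤∸ j) (≤-reflexive (m≤n⇒m∸n≡0 x≤j)))
  where
  >>≤∸ : ∀ j → x >> j ≤ x ∸ j
  >>≤∸ zero    = ≤-refl
  >>≤∸ (suc j) = begin
    ⌊ x >> j /2⌋    ≤⟨ ⌊n/2⌋≤n∸1 (x >> j) ⟩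
    x >> j ∸ 1      ≤⟨ ∸-monoˡ-≤ 1 (>>≤∸ j) ⟩
    x ∸ j ∸ 1       ≡⟨ ∸-+-assoc x j 1 ⟩
    x ∸ (j + 1)     ≡⟨ cong (x ∸_) (+-comm j 1) ⟩
    x ∸ suc j       ∎
    where open ≤-Reasoning

>>≢0⇒2^≤ : ∀ j {x} → x >> j ≢ 0 → 2 ^ j ≤ x
>>≢0⇒2^≤ zero    {x} x≢0 = n≢0⇒n>0 x≢0
>>≢0⇒2^≤ (suc j) {x} x>>j≢0 = begin
  2 * 2 ^ j      ≤⟨ *-monoʳ-≤ 2 (>>≢0⇒2^≤ j (x>>j≢0 ∘ trans (sym (⌊/2⌋>> x j)))) ⟩
  2 * ⌊ x /2⌋    ≤⟨ 2*⌊n/2⌋≤n x ⟩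
  x              ∎
  where open ≤-Reasoning

>>-surjective : ∀ j P → ∃[ W ] W >> j ≡ P
>>-surjective zero    P = P , refl
>>-surjective (suc j) P with W , W>>j≡P ← >>-surjective j P =
  W + W , trans (sym (⌊/2⌋>> (W + W) j)) (trans (cong (_>> j) (sym (n≡⌊n+n/2⌋ W))) W>>j≡P)

>>-agree-≤ : ∀ {i j} x y → i ≤ j → x >> i ≡ y >> i → x >> j ≡ y >> j
>>-agree-≤ {i} {j} x y i≤j eq = begin
  x >> j              ≡⟨ cong (x >>_) (m+[n∸m]≡n i≤j) ⟨
  x >> (i + (j ∸ i))  ≡⟨ >>-+ x i (j ∸ i) ⟩
  x >> i >> (j ∸ i)   ≡⟨ cong (_>> (j ∸ i)) eq ⟩
  y >> i >> (j ∸ i)   ≡⟨ >>-+ y i (j ∸ i) ⟨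
  y >> (i + (j ∸ i))  ≡⟨ cong (y >>_) (m+[n∸m]≡n i≤j) ⟩
  y >> j              ∎
  where open ≡-Reasoning

>>≡0-anti : ∀ j {x y} → x ≤ y → y >> j ≡ 0 → x >> j ≡ 0
>>≡0-anti j x≤y y>>j≡0 = n≤0⇒n≡0 (subst (_ ≤_) y>>j≡0 (>>-mono-≤ j x≤y))

>>≡0-mono : ∀ {i j} x → i ≤ j → x >> i ≡ 0 → x >> j ≡ 0
>>≡0-mono {i} {j} x i≤j x>>i≡0 = trans (>>-agree-≤ x 0 i≤j (trans x>>i≡0 (sym (0>> i)))) (0>> j)

infix 4 _<[_]_
_<[_]_ : ℕ → ℕ → ℕ → Set
x <[ i ] y = x >> suc i ≡ y >> suc i × parity (x >> i) ≡ 0ℙ × parity (y >> i) ≡ 1ℙ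

<[]⇒< : ∀ {x y} i → x <[ i ] y → x < y
<[]⇒< {x} {y} i (above , px , py) = >>-cancel-< i (begin-strict
  x >> i                                      ≡⟨ parity+2*⌊/2⌋ (x >> i) ⟨
  toℕ (parity (x >> i)) + 2 * (x >> suc i)    ≡⟨ cong₂ (λ p q → toℕ p + 2 * q) px above ⟩
  2 * (y >> suc i)                            <⟨ n<1+n _ ⟩
  toℕ 1ℙ + 2 * (y >> suc i)                   ≡⟨ cong (λ p → toℕ p + 2 * (y >> suc i)) py ⟨
  toℕ (parity (y >> i)) + 2 * (y >> suc i)    ≡⟨ parity+2*⌊/2⌋ (y >> i) ⟩
  y >> i                                      ∎)
  where open ≤-Reasoning

<[]-⌊/2⌋ : ∀ {x y} i → ⌊ x /2⌋ <[ i ] ⌊ y /2⌋ → x <[ suc i ] y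
<[]-⌊/2⌋ {x} {y} i (above , px , py) =
  trans (sym (⌊/2⌋>> x (suc i))) (trans above (⌊/2⌋>> y (suc i))) ,
  trans (cong parity (sym (⌊/2⌋>> x i))) px ,
  trans (cong parity (sym (⌊/2⌋>> y i))) py

<⇒<[] : ∀ {x y} → x < y → ∃[ i ] x <[ i ] y
<⇒<[] {x} {y} = binary-ind₂ (λ x y → x < y → ∃[ i ] x <[ i ] y) (λ ()) step x y
  where
  step : ∀ x y → (⌊ x /2⌋ < ⌊ y /2⌋ → ∃[ i ] ⌊ x /2⌋ <[ i ] ⌊ y /2⌋) → x < y → ∃[ i ] x <[ i ] y
  step x y ih x<y with ⌊ x /2⌋ ≟ ⌊ y /2⌋
  ... | no halves≢ with i , x<[i]y ← ih (≤∧≢⇒< (⌊n/2⌋-mono (<⇒≤ x<y)) halves≢) =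
    suc i , <[]-⌊/2⌋ i x<[i]y
  ... | yes halves≡ with parity x in px | parity y in py
  ...   | 0ℙ | 1ℙ = 0 , halves≡ , px , py
  ...   | 1ℙ | 0ℙ = contradiction (<[]⇒< 0 (sym halves≡ , py , px)) (<⇒≯ x<y)
  ...   | 0ℙ | 0ℙ = contradiction (parity∧⌊/2⌋⇒≡ (trans px (sym py)) halves≡) (<⇒≢ x<y)
  ...   | 1ℙ | 1ℙ = contradiction (parity∧⌊/2⌋⇒≡ (trans px (sym py)) halves≡) (<⇒≢ x<y)

-- Nim-sum

/2^≡>> : ∀ x j → x /2^ j ≡ x >> j
/2^≡>> x zero    = n/1≡n x
/2^≡>> x (suc j) = begin
  x /2^ suc j                ≡⟨ /-congʳ (*-comm 2 (2 ^ j)) ⟩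
  x / (2 ^ j * 2)            ≡⟨ m/n/o≡m/[n*o] x (2 ^ j) 2 ⟨
  x /2^ j / 2                ≡⟨ /2≡⌊/2⌋ (x /2^ j) ⟩
  ⌊ x /2^ j /2⌋              ≡⟨ cong ⌊_/2⌋ (/2^≡>> x j) ⟩
  ⌊ x >> j /2⌋               ∎
  where
  open ≡-Reasoning
  instance
    2^j≢0 : NonZero (2 ^ j)
    2^j≢0 = m^n≢0 2 j
    2^[1+j]≢0 : NonZero (2 ^ suc j)
    2^[1+j]≢0 = m^n≢0 2 (suc j)
    2^j*2≢0 : NonZero (2 ^ j * 2)
    2^j*2≢0 = m*n≢0 (2 ^ j) 2
  /2≡⌊/2⌋ : ∀ n → n / 2 ≡ ⌊ n /2⌋
  /2≡⌊/2⌋ 0             = refl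
  /2≡⌊/2⌋ 1             = refl
  /2≡⌊/2⌋ (suc (suc n)) =
    trans (m/n≡1+[m∸n]/n {suc (suc n)} {2} (s≤s (s≤s z≤n))) (cong suc (/2≡⌊/2⌋ n))

bit≡parity>> : ∀ i x → bit i x ≡ toℕ (parity (x >> i))
bit≡parity>> i x = trans (cong (_% 2) (/2^≡>> x i)) (%2≡parity (x >> i))
  where
  %2≡parity : ∀ n → n % 2 ≡ toℕ (parity n)
  %2≡parity 0             = refl
  %2≡parity 1             = refl
  %2≡parity (suc (suc n)) = trans (cong (_% 2) (+-comm 2 n)) (trans ([m+n]%n≡m%n n 2) (%2≡parity n))

bit-suc : ∀ i x → bit (suc i) x ≡ bit i ⌊ x /2⌋
bit-suc i x = begin
  bit (suc i) x                  ≡⟨ bit≡parity>> (suc i) x ⟩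
  toℕ (parity (x >> suc i))      ≡⟨ cong (toℕ ∘ parity) (⌊/2⌋>> x i) ⟨
  toℕ (parity (⌊ x /2⌋ >> i))    ≡⟨ bit≡parity>> i ⌊ x /2⌋ ⟨
  bit i ⌊ x /2⌋                  ∎
  where open ≡-Reasoning

xorUpTo-suc : ∀ n x y →
  xorUpTo (suc n) x y ≡ toℕ (parity x ℙ.+ parity y) + 2 * xorUpTo n ⌊ x /2⌋ ⌊ y /2⌋
xorUpTo-suc zero x y
  rewrite bit≡parity>> 0 x | bit≡parity>> 0 y | toℕ-+ (parity x) (parity y) = refl
xorUpTo-suc (suc n) x y
  rewrite xorUpTo-suc n x y | bit-suc n x | bit-suc n y =
  regroup (toℕ (parity x ℙ.+ parity y)) (xorUpTo n ⌊ x /2⌋ ⌊ y /2⌋) (2 ^ n)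
          (bitXor (bit n ⌊ x /2⌋) (bit n ⌊ y /2⌋))
  where
  regroup : ∀ b X p B → b + 2 * X + 2 * p * B ≡ b + 2 * (X + p * B)
  regroup = solve-∀

xorUpTo-stable : ∀ {m x y} n → x ≤ m → y ≤ m → m ≤ n → xorUpTo n x y ≡ xorUpTo m x y
xorUpTo-stable n x≤m y≤m m≤n with m≤n⇒m<n∨m≡n m≤n
... | inj₂ refl = refl
xorUpTo-stable {m} {x} {y} (suc n) x≤m y≤m _ | inj₁ (s≤s m≤n) = begin
  xorUpTo n x y + 2 ^ n * bitXor (bit n x) (bit n y)
    ≡⟨ cong₂ (λ a b → xorUpTo n x y + 2 ^ n * bitXor a b) (bit≡0 x≤m) (bit≡0 y≤m) ⟩
  xorUpTo n x y + 2 ^ n * 0                           ≡⟨ cong (xorUpTo n x y +_) (*-zeroʳ (2 ^ n)) ⟩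
  xorUpTo n x y + 0                                   ≡⟨ +-identityʳ _ ⟩
  xorUpTo n x y                                       ≡⟨ xorUpTo-stable n x≤m y≤m m≤n ⟩
  xorUpTo m x y                                       ∎
  where
  open ≡-Reasoning
  bit≡0 : ∀ {a} → a ≤ m → bit n a ≡ 0
  bit≡0 {a} a≤m = trans (bit≡parity>> n a) (cong (toℕ ∘ parity) (m≤n⇒m>>n≡0 n (≤-trans a≤m m≤n)))

⊕-unfold : ∀ x y → x ⊕ y ≡ toℕ (parity x ℙ.+ parity y) + 2 * (⌊ x /2⌋ ⊕ ⌊ y /2⌋)
⊕-unfold zero    zero    = refl
⊕-unfold zero    (suc b) =
  trans (xorUpTo-suc b 0 (suc b))
        (cong (λ q → toℕ (parity (suc b)) + 2 * q) (xorUpTo-stable b z≤n ≤-refl (⌊n/2⌋≤n∸1 (suc b))))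
⊕-unfold (suc a) y       =
  trans (xorUpTo-suc (a + y) (suc a) y)
        (cong (λ q → toℕ (parity (suc a) ℙ.+ parity y) + 2 * q)
              (xorUpTo-stable (a + y) (m≤m+n _ _) (m≤n+m _ _) (+-mono-≤ (⌊n/2⌋≤n∸1 (suc a)) (⌊n/2⌋≤n y))))

parity-⊕ : ∀ x y → parity (x ⊕ y) ≡ parity x ℙ.+ parity y
parity-⊕ x y rewrite ⊕-unfold x y = parity-+2* (parity x ℙ.+ parity y) (⌊ x /2⌋ ⊕ ⌊ y /2⌋)

⌊⊕/2⌋ : ∀ x y → ⌊ x ⊕ y /2⌋ ≡ ⌊ x /2⌋ ⊕ ⌊ y /2⌋
⌊⊕/2⌋ x y rewrite ⊕-unfold x y = ⌊+2*/2⌋ (parity x ℙ.+ parity y) (⌊ x /2⌋ ⊕ ⌊ y /2⌋)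

>>-distrib-⊕ : ∀ j x y → (x ⊕ y) >> j ≡ x >> j ⊕ y >> j
>>-distrib-⊕ zero    x y = refl
>>-distrib-⊕ (suc j) x y = trans (cong ⌊_/2⌋ (>>-distrib-⊕ j x y)) (⌊⊕/2⌋ (x >> j) (y >> j))

⊕-comm : ∀ x y → x ⊕ y ≡ y ⊕ x
⊕-comm = binary-ind₂ (λ x y → x ⊕ y ≡ y ⊕ x) refl λ x y ih → parity∧⌊/2⌋⇒≡
  (trans (parity-⊕ x y) (trans (ℙ.+-comm (parity x) (parity y)) (sym (parity-⊕ y x))))
  (trans (⌊⊕/2⌋ x y) (trans ih (sym (⌊⊕/2⌋ y x))))

⊕-identityˡ : ∀ x → 0 ⊕ x ≡ x
⊕-identityˡ = binary-ind₂ (λ _ x → 0 ⊕ x ≡ x) refl (λ _ x ih → parity∧⌊/2⌋⇒≡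
  (parity-⊕ 0 x) (trans (⌊⊕/2⌋ 0 x) ih)) 0

[x⊕y]⊕y≡x : ∀ x y → (x ⊕ y) ⊕ y ≡ x
[x⊕y]⊕y≡x = binary-ind₂ (λ x y → (x ⊕ y) ⊕ y ≡ x) refl λ x y ih → parity∧⌊/2⌋⇒≡
  (begin
    parity ((x ⊕ y) ⊕ y)                      ≡⟨ parity-⊕ (x ⊕ y) y ⟩
    parity (x ⊕ y) ℙ.+ parity y               ≡⟨ cong (ℙ._+ parity y) (parity-⊕ x y) ⟩
    parity x ℙ.+ parity y ℙ.+ parity y        ≡⟨ ℙ.+-assoc (parity x) (parity y) (parity y) ⟩
    parity x ℙ.+ (parity y ℙ.+ parity y)      ≡⟨ cong (parity x ℙ.+_) (ℙ.p+p≡0ℙ (parity y)) ⟩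
    parity x ℙ.+ 0ℙ                           ≡⟨ ℙ.+-identityʳ (parity x) ⟩
    parity x                                  ∎)
  (trans (⌊⊕/2⌋ (x ⊕ y) y) (trans (cong (_⊕ ⌊ y /2⌋) (⌊⊕/2⌋ x y)) ih))
  where open ≡-Reasoning

x⊕[x⊕y]≡y : ∀ x y → x ⊕ (x ⊕ y) ≡ y
x⊕[x⊕y]≡y x y = trans (⊕-comm x (x ⊕ y)) (trans (cong (_⊕ x) (⊕-comm x y)) ([x⊕y]⊕y≡x y x))

[x⊕y]⊕x≡y : ∀ x y → (x ⊕ y) ⊕ x ≡ y
[x⊕y]⊕x≡y x y = trans (⊕-comm (x ⊕ y) x) (x⊕[x⊕y]≡y x y)

x⊕[y⊕x]≡y : ∀ x y → x ⊕ (y ⊕ x) ≡ y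
x⊕[y⊕x]≡y x y = trans (cong (x ⊕_) (⊕-comm y x)) (x⊕[x⊕y]≡y x y)

⊕-cancelʳ-≡ : ∀ {x y} z → x ⊕ z ≡ y ⊕ z → x ≡ y
⊕-cancelʳ-≡ {x} {y} z eq = trans (sym ([x⊕y]⊕y≡x x z)) (trans (cong (_⊕ z) eq) ([x⊕y]⊕y≡x y z))

⊕-cancelˡ-≡ : ∀ {x y} z → z ⊕ x ≡ z ⊕ y → x ≡ y
⊕-cancelˡ-≡ {x} {y} z eq = trans (sym (x⊕[x⊕y]≡y z x)) (trans (cong (z ⊕_) eq) (x⊕[x⊕y]≡y z y))

+-unfold : ∀ x y → x + y ≡ toℕ (parity x) + toℕ (parity y) + 2 * (⌊ x /2⌋ + ⌊ y /2⌋)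
+-unfold x y = sym (trans (regroup (toℕ (parity x)) (toℕ (parity y)) ⌊ x /2⌋ ⌊ y /2⌋)
                          (cong₂ _+_ (parity+2*⌊/2⌋ x) (parity+2*⌊/2⌋ y)))
  where
  regroup : ∀ a b c d → a + b + 2 * (c + d) ≡ (a + 2 * c) + (b + 2 * d)
  regroup = solve-∀

⊕≤+ : ∀ x y → x ⊕ y ≤ x + y
⊕≤+ = binary-ind₂ (λ x y → x ⊕ y ≤ x + y) z≤n λ x y ih → begin
  x ⊕ y                                                        ≡⟨ ⊕-unfold x y ⟩
  toℕ (parity x ℙ.+ parity y) + 2 * (⌊ x /2⌋ ⊕ ⌊ y /2⌋)
    ≤⟨ +-mono-≤ (toℕ-+≤ (parity x) (parity y)) (*-monoʳ-≤ 2 ih) ⟩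
  toℕ (parity x) + toℕ (parity y) + 2 * (⌊ x /2⌋ + ⌊ y /2⌋)    ≡⟨ +-unfold x y ⟨
  x + y                                                        ∎
  where
  open ≤-Reasoning
  toℕ-+≤ : ∀ p q → toℕ (p ℙ.+ q) ≤ toℕ p + toℕ q
  toℕ-+≤ 0ℙ q  = ≤-refl
  toℕ-+≤ 1ℙ 0ℙ = ≤-refl
  toℕ-+≤ 1ℙ 1ℙ = z≤n

parity>>-⊕ : ∀ i x y → parity ((x ⊕ y) >> i) ≡ parity (x >> i) ℙ.+ parity (y >> i)
parity>>-⊕ i x y = trans (cong parity (>>-distrib-⊕ i x y)) (parity-⊕ (x >> i) (y >> i))

>>-⊕-small : ∀ j {y} Z → y >> j ≡ 0 → (y ⊕ Z) >> j ≡ Z >> j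
>>-⊕-small j {y} Z y>>j≡0 =
  trans (>>-distrib-⊕ j y Z) (trans (cong (_⊕ Z >> j) y>>j≡0) (⊕-identityˡ (Z >> j)))

⊕≡+⇒lowBitsDisjoint : ∀ {x y} → x ⊕ y ≡ x + y → parity x ≡ 1ℙ → parity y ≡ 0ℙ
⊕≡+⇒lowBitsDisjoint {x} {y} eq px with parity y in py
... | 0ℙ = refl
... | 1ℙ = contradiction eq (<⇒≢ (begin-strict
  x ⊕ y                                                     ≡⟨ ⊕-unfold x y ⟩
  toℕ (parity x ℙ.+ parity y) + 2 * (⌊ x /2⌋ ⊕ ⌊ y /2⌋)
    ≡⟨ cong₂ (λ p q → toℕ (p ℙ.+ q) + 2 * (⌊ x /2⌋ ⊕ ⌊ y /2⌋)) px py ⟩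
  2 * (⌊ x /2⌋ ⊕ ⌊ y /2⌋)                                   ≤⟨ *-monoʳ-≤ 2 (⊕≤+ ⌊ x /2⌋ ⌊ y /2⌋) ⟩
  2 * (⌊ x /2⌋ + ⌊ y /2⌋)                                   <⟨ m<n+m _ {2} z<s ⟩
  toℕ 1ℙ + toℕ 1ℙ + 2 * (⌊ x /2⌋ + ⌊ y /2⌋)
    ≡⟨ cong₂ (λ p q → toℕ p + toℕ q + 2 * (⌊ x /2⌋ + ⌊ y /2⌋)) px py ⟨
  toℕ (parity x) + toℕ (parity y) + 2 * (⌊ x /2⌋ + ⌊ y /2⌋) ≡⟨ +-unfold x y ⟨
  x + y                                                     ∎))
  where open ≤-Reasoning

⊕≡+⇒⌊/2⌋ : ∀ {x y} → x ⊕ y ≡ x + y → ⌊ x /2⌋ ⊕ ⌊ y /2⌋ ≡ ⌊ x /2⌋ + ⌊ y /2⌋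
⊕≡+⇒⌊/2⌋ {x} {y} eq = *-cancelˡ-≡ _ _ 2 (+-cancelˡ-≡ (toℕ (parity x ℙ.+ parity y)) _ _ (begin
  toℕ (parity x ℙ.+ parity y) + 2 * (⌊ x /2⌋ ⊕ ⌊ y /2⌋)     ≡⟨ ⊕-unfold x y ⟨
  x ⊕ y                                                     ≡⟨ eq ⟩
  x + y                                                     ≡⟨ +-unfold x y ⟩
  toℕ (parity x) + toℕ (parity y) + 2 * (⌊ x /2⌋ + ⌊ y /2⌋)
    ≡⟨ cong (_+ 2 * (⌊ x /2⌋ + ⌊ y /2⌋)) (noCarry (parity x) (parity y) (⊕≡+⇒lowBitsDisjoint {x} {y} eq)) ⟩
  toℕ (parity x ℙ.+ parity y) + 2 * (⌊ x /2⌋ + ⌊ y /2⌋)     ∎))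
  where
  open ≡-Reasoning
  noCarry : ∀ p q → (p ≡ 1ℙ → q ≡ 0ℙ) → toℕ p + toℕ q ≡ toℕ (p ℙ.+ q)
  noCarry 0ℙ q  _ = refl
  noCarry 1ℙ 0ℙ _ = refl
  noCarry 1ℙ 1ℙ disjoint with () ← disjoint refl

⊕≡+⇒bitsDisjoint : ∀ j {x y} → x ⊕ y ≡ x + y → parity (x >> j) ≡ 1ℙ → parity (y >> j) ≡ 0ℙ
⊕≡+⇒bitsDisjoint zero {x} {y} eq = ⊕≡+⇒lowBitsDisjoint {x} {y} eq
⊕≡+⇒bitsDisjoint (suc j) {x} {y} eq xⱼ≡1 =
  subst (λ n → parity n ≡ 0ℙ) (⌊/2⌋>> y j)
    (⊕≡+⇒bitsDisjoint j (⊕≡+⇒⌊/2⌋ {x} {y} eq) (subst (λ n → parity n ≡ 1ℙ) (sym (⌊/2⌋>> x j)) xⱼ≡1))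

2^j>>j≡1 : ∀ j → (2 ^ j) >> j ≡ 1
2^j>>j≡1 zero    = refl
2^j>>j≡1 (suc j) = trans (sym (⌊/2⌋>> (2 ^ suc j) j)) (trans (cong (_>> j) (⌊+2*/2⌋ 0ℙ (2 ^ j))) (2^j>>j≡1 j))

-- "2 ^ k divides s", phrased as: s is the least W with s >> k ≤ W >> k.
LowBitsZero : ℕ → ℕ → Set
LowBitsZero k s = ∀ W → s >> k ≤ W >> k → s ≤ W

lowestSetBit : ∀ s → 1 ≤ s → ∃[ k ] LowBitsZero k s × parity (s >> k) ≡ 1ℙ
lowestSetBit = <-rec (λ s → 1 ≤ s → ∃[ k ] LowBitsZero k s × parity (s >> k) ≡ 1ℙ) step
  where
  step : ∀ s → (∀ {t} → t < s → 1 ≤ t → ∃[ k ] LowBitsZero k t × parity (t >> k) ≡ 1ℙ) →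
         1 ≤ s → ∃[ k ] LowBitsZero k s × parity (s >> k) ≡ 1ℙ
  step s@(suc n) rec _ with parity s in ps
  ... | 1ℙ = 0 , (λ _ s≤W → s≤W) , ps
  ... | 0ℙ = shiftUp (rec (⌊n/2⌋<n n) (n≢0⇒n>0 ⌊s/2⌋≢0))
    where
    s≡2*⌊s/2⌋ : s ≡ 2 * ⌊ s /2⌋
    s≡2*⌊s/2⌋ = trans (sym (parity+2*⌊/2⌋ s)) (cong (λ p → toℕ p + 2 * ⌊ s /2⌋) ps)
    ⌊s/2⌋≢0 : ⌊ s /2⌋ ≢ 0
    ⌊s/2⌋≢0 ⌊s/2⌋≡0 with () ← trans s≡2*⌊s/2⌋ (cong (2 *_) ⌊s/2⌋≡0)
    shiftUp : ∃[ k ] LowBitsZero k ⌊ s /2⌋ × parity (⌊ s /2⌋ >> k) ≡ 1ℙ →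
              ∃[ k ] LowBitsZero k s × parity (s >> k) ≡ 1ℙ
    shiftUp (k , aligned , odd) = suc k , aligned′ , trans (cong parity (sym (⌊/2⌋>> s k))) odd
      where
      aligned′ : LowBitsZero (suc k) s
      aligned′ W s>>≤W>> = begin
        s              ≡⟨ s≡2*⌊s/2⌋ ⟩
        2 * ⌊ s /2⌋    ≤⟨ *-monoʳ-≤ 2 (aligned ⌊ W /2⌋ ⌊s/2⌋>>k≤⌊W/2⌋>>k) ⟩
        2 * ⌊ W /2⌋    ≤⟨ 2*⌊n/2⌋≤n W ⟩
        W              ∎
        where
        open ≤-Reasoning
        ⌊s/2⌋>>k≤⌊W/2⌋>>k : ⌊ s /2⌋ >> k ≤ ⌊ W /2⌋ >> k
        ⌊s/2⌋>>k≤⌊W/2⌋>>k = subst₂ _≤_ (sym (⌊/2⌋>> s k)) (sym (⌊/2⌋>> W k)) s>>≤W>>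

-- Otherwise i = 2 ^ k ≤ b would share bit k with s.
noCarry⇒>>≡0 : ∀ {k s b} → parity (s >> k) ≡ 1ℙ → (∀ i → i ≤ b → i ⊕ s ≡ i + s) → b >> k ≡ 0
noCarry⇒>>≡0 {k} {s} {b} sₖ≡1 noCarry with b >> k ≟ 0
... | yes b>>k≡0 = b>>k≡0
... | no  b>>k≢0 with () ← trans (sym sₖ≡1)
  (⊕≡+⇒bitsDisjoint k (noCarry (2 ^ k) (>>≢0⇒2^≤ k b>>k≢0)) (cong parity (2^j>>j≡1 k)))

-- Grundy values

∈⇒T-elem : ∀ {k xs} → k ∈ xs → T (elem k xs)
∈⇒T-elem {k} = any⁺ _ ∘ Any.map (≡⇒≡ᵇ k _)

T-elem⇒∈ : ∀ {k} xs → T (elem k xs) → k ∈ xs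
T-elem⇒∈ {k} xs = Any.map (≡ᵇ⇒≡ k _) ∘ any⁻ _ xs

mexFrom≡ : ∀ {xs t} n k → k ≤ t → t ≤ k + n → (∀ {j} → k ≤ j → j < t → j ∈ xs) → t ∉ xs →
           mexFrom n k xs ≡ t
mexFrom≡ zero k k≤t t≤k+0 _ _ = ≤-antisym k≤t (subst (_ ≤_) (+-identityʳ k) t≤k+0)
mexFrom≡ {xs} {t} (suc n) k k≤t t≤k+n below t∉xs with elem k xs in k∈?xs
... | true  = mexFrom≡ n (suc k) k<t (subst (t ≤_) (+-suc k n) t≤k+n) (below ∘ <⇒≤) t∉xs
  where
  k<t : k < t
  k<t = ≤∧≢⇒< k≤t (λ { refl → t∉xs (T-elem⇒∈ xs (subst T (sym k∈?xs) _)) })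
... | false = ≤-antisym k≤t (≮⇒≥ (λ k<t → subst T k∈?xs (∈⇒T-elem (below ≤-refl k<t))))

mex≡ : ∀ {xs t} → t ≤ length xs → (∀ {j} → j < t → j ∈ xs) → t ∉ xs → mex xs ≡ t
mex≡ t≤length below = mexFrom≡ _ 0 z≤n t≤length (λ _ → below)

optionValues : (ℕ → ℕ) → (ℕ → ℕ → ℕ) → ℕ → ℕ → List ℕ
optionValues f φ y z = map (λ v → φ v z) (upTo y) ++ map (λ w → φ (y ⊓ f w) w) (upTo z)

-- `mex` searches only up to the length of its list, hence `bounded`.
record IsGrundyLabelling (f : ℕ → ℕ) (φ : ℕ → ℕ → ℕ) : Set where
  field
    bounded  : ∀ {y z} → y ≤ f z → φ y z ≤ y + z
    realizes : ∀ {y z j} → y ≤ f z → j < φ y z →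
               (∃[ v ] v < y × φ v z ≡ j) ⊎ (∃[ w ] w < z × φ (y ⊓ f w) w ≡ j)
    lower-≢  : ∀ {y z v} → y ≤ f z → v < y → φ v z ≢ φ y z
    left-≢   : ∀ {y z w} → y ≤ f z → w < z → φ (y ⊓ f w) w ≢ φ y z

module _ {f : ℕ → ℕ} {φ : ℕ → ℕ → ℕ} (isGrundy : IsGrundyLabelling f φ) where
  open IsGrundyLabelling isGrundy

  mex-optionValues : ∀ {y z} → y ≤ f z → mex (optionValues f φ y z) ≡ φ y z
  mex-optionValues {y} {z} y≤fz = mex≡ φ≤length below φ∉
    where
    lower left : List ℕ
    lower = map (λ v → φ v z) (upTo y)
    left  = map (λ w → φ (y ⊓ f w) w) (upTo z)
    φ≤length : φ y z ≤ length (optionValues f φ y z)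
    φ≤length = subst (φ y z ≤_) (sym (trans (length-++ lower)
      (cong₂ _+_ (trans (length-map _ (upTo y)) (length-upTo y)) (trans (length-map _ (upTo z)) (length-upTo z)))))
      (bounded y≤fz)
    below : ∀ {j} → j < φ y z → j ∈ optionValues f φ y z
    below j<φ with realizes y≤fz j<φ
    ... | inj₁ (v , v<y , refl) = ∈-++⁺ˡ (∈-map⁺ _ (∈-upTo⁺ v<y))
    ... | inj₂ (w , w<z , refl) = ∈-++⁺ʳ lower (∈-map⁺ _ (∈-upTo⁺ w<z))
    φ∉ : φ y z ∉ optionValues f φ y z
    φ∉ φ∈ with ∈-++⁻ lower φ∈
    ... | inj₁ φ∈lower with v , v∈ , eq ← ∈-map⁻ _ φ∈lower = lower-≢ y≤fz (∈-upTo⁻ v∈) (sym eq)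
    ... | inj₂ φ∈left  with w , w∈ , eq ← ∈-map⁻ _ φ∈left  = left-≢ y≤fz (∈-upTo⁻ w∈) (sym eq)

  grundyFuel≡ : ∀ n {y z} → y + z < n → y ≤ f z → grundyFuel n f y z ≡ φ y z
  grundyFuel≡ (suc n) {y} {z} (s≤s y+z≤n) y≤fz =
    trans (cong mex (cong₂ _++_ (map-cong-local (All.map lower (all-upTo y)))
                                (map-cong-local (All.map left (all-upTo z)))))
          (mex-optionValues y≤fz)
    where
    lower : ∀ {v} → v < y → grundyFuel n f v z ≡ φ v z
    lower {v} v<y = grundyFuel≡ n (≤-trans (+-monoˡ-< z v<y) y+z≤n) (≤-trans (<⇒≤ v<y) y≤fz)
    left : ∀ {w} → w < z → grundyFuel n f (y ⊓ f w) w ≡ φ (y ⊓ f w) w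
    left {w} w<z = grundyFuel≡ n (≤-trans (+-mono-≤-< (m⊓n≤m y (f w)) w<z) y+z≤n) (m⊓n≤n y (f w))

  G≡ : ∀ {y z} → y ≤ f z → G f y z ≡ φ y z
  G≡ y≤fz = grundyFuel≡ _ ≤-refl y≤fz

-- The game CB(h_s)

ConditionA>> : (ℕ → ℕ) → Set
ConditionA>> h = ∀ z z' j → z >> suc j ≡ z' >> suc j → h z >> j ≡ h z' >> j

conditionA⇒>> : ∀ {h} → ConditionA h → ConditionA>> h
conditionA⇒>> {h} condA z z' j above =
  trans (sym (/2^≡>> (h z) j))
        (trans (condA z z' j (trans (/2^≡>> z (suc j)) (trans above (sym (/2^≡>> z' (suc j))))))
               (/2^≡>> (h z') j))

⊓-conditionA>> : ∀ {h} y → ConditionA>> h → ConditionA>> (λ W → y ⊓ h W)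
⊓-conditionA>> {h} y condA z z' j above = begin
  (y ⊓ h z) >> j          ≡⟨ >>-distrib-⊓ j y (h z) ⟩
  y >> j ⊓ h z >> j       ≡⟨ cong (y >> j ⊓_) (condA z z' j above) ⟩
  y >> j ⊓ h z' >> j      ≡⟨ >>-distrib-⊓ j y (h z') ⟨
  (y ⊓ h z') >> j         ∎
  where open ≡-Reasoning

-- Refining the block bit by bit, condition (a) keeps the high part of g constant on each refinement.
⊕-blockSurjective : ∀ {g} → ConditionA>> g → ∀ n {P q} → (∀ W → W >> n ≡ P → g W >> n ≡ q) →
                    ∀ x → x >> n ≡ q ⊕ P → ∃[ W ] W >> n ≡ P × g W ⊕ W ≡ x
⊕-blockSurjective condA zero {P} {q} constant x x≡q⊕P =
  P , refl , trans (cong (_⊕ P) (constant P refl)) (sym x≡q⊕P)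
⊕-blockSurjective {g} condA (suc n) {P} {q} constant x x≡q⊕P =
  coarsen (⊕-blockSurjective condA n constant′ x (sym (x⊕[x⊕y]≡y q′ (x >> n))))
  where
  W₀ : ℕ
  W₀ = proj₁ (>>-surjective (suc n) P)
  W₀>>≡P : W₀ >> suc n ≡ P
  W₀>>≡P = proj₂ (>>-surjective (suc n) P)
  q′ P′ : ℕ
  q′ = g W₀ >> n
  P′ = q′ ⊕ x >> n
  ⌊P′/2⌋≡P : ⌊ P′ /2⌋ ≡ P
  ⌊P′/2⌋≡P = begin
    ⌊ q′ ⊕ x >> n /2⌋          ≡⟨ ⌊⊕/2⌋ q′ (x >> n) ⟩
    g W₀ >> suc n ⊕ x >> suc n ≡⟨ cong₂ _⊕_ (constant W₀ W₀>>≡P) x≡q⊕P ⟩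
    q ⊕ (q ⊕ P)                ≡⟨ x⊕[x⊕y]≡y q P ⟩
    P                          ∎
    where open ≡-Reasoning
  constant′ : ∀ W → W >> n ≡ P′ → g W >> n ≡ q′
  constant′ W W>>n≡P′ = condA W W₀ n (trans (cong ⌊_/2⌋ W>>n≡P′) (trans ⌊P′/2⌋≡P (sym W₀>>≡P)))
  coarsen : ∃[ W ] W >> n ≡ P′ × g W ⊕ W ≡ x → ∃[ W ] W >> suc n ≡ P × g W ⊕ W ≡ x
  coarsen (W , W>>n≡P′ , gW⊕W≡x) = W , trans (cong ⌊_/2⌋ W>>n≡P′) ⌊P′/2⌋≡P , gW⊕W≡x

⊕-option-≢ : ∀ {h} → ConditionA>> h → ∀ {y Z W} → y ≤ h Z → W < Z → (y ⊓ h W) ⊕ W ≢ y ⊕ Z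
⊕-option-≢ {h} condA {y} {Z} {W} y≤hZ W<Z with ≤-total y (h W)
... | inj₁ y≤hW rewrite m≤n⇒m⊓n≡m y≤hW = <⇒≢ W<Z ∘ ⊕-cancelˡ-≡ y
... | inj₂ hW≤y rewrite m≥n⇒m⊓n≡n hW≤y = λ eq → splitImpossible eq (<⇒<[] W<Z)
  where
  splitImpossible : h W ⊕ W ≡ y ⊕ Z → ¬ (∃[ i ] W <[ i ] Z)
  splitImpossible eq (i , above , Wᵢ≡0 , Zᵢ≡1) = contradiction (ℙ.+-cancelˡ-≡ (parity (y >> i)) 0ℙ 1ℙ (begin
    parity (y >> i) ℙ.+ 0ℙ                ≡⟨ cong₂ ℙ._+_ (cong parity hWᵢ≡yᵢ) Wᵢ≡0 ⟨
    parity (h W >> i) ℙ.+ parity (W >> i) ≡⟨ parity>>-⊕ i (h W) W ⟨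
    parity ((h W ⊕ W) >> i)               ≡⟨ cong (parity ∘ (_>> i)) eq ⟩
    parity ((y ⊕ Z) >> i)                 ≡⟨ parity>>-⊕ i y Z ⟩
    parity (y >> i) ℙ.+ parity (Z >> i)   ≡⟨ cong (parity (y >> i) ℙ.+_) Zᵢ≡1 ⟩
    parity (y >> i) ℙ.+ 1ℙ                ∎)) λ ()
    where
    open ≡-Reasoning
    hWᵢ≡yᵢ : h W >> i ≡ y >> i
    hWᵢ≡yᵢ = ≤-antisym (>>-mono-≤ i hW≤y) (subst (y >> i ≤_) (sym (condA W Z i above)) (>>-mono-≤ i y≤hZ))

module _ {h : ℕ → ℕ} (nondecreasing : Nondecreasing h) (condA : ConditionA>> h)
         {s k : ℕ} (s-aligned : LowBitsZero k s) (hs>>k≡0 : h s >> k ≡ 0) where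

  s≤⊕ : ∀ {y Z} → y ≤ h Z → s ≤ Z → s ≤ y ⊕ Z
  s≤⊕ {y} {Z} y≤hZ s≤Z with m≤n⇒m<n∨m≡n s≤Z
  ... | inj₂ refl = s-aligned (y ⊕ s) (≤-reflexive (sym (>>-⊕-small k s (>>≡0-anti k y≤hZ hs>>k≡0))))
  ... | inj₁ s<Z with i , above , sᵢ≡0 , Zᵢ≡1 ← <⇒<[] s<Z with ≤-total k i
  ...   | inj₁ k≤i =
    <⇒≤ (<[]⇒< i (trans above (cong ⌊_/2⌋ (sym y⊕Zᵢ≡Zᵢ)) , sᵢ≡0 , trans (cong parity y⊕Zᵢ≡Zᵢ) Zᵢ≡1))
    where
    y⊕Zᵢ≡Zᵢ : (y ⊕ Z) >> i ≡ Z >> i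
    y⊕Zᵢ≡Zᵢ = >>-⊕-small i Z
      (>>≡0-anti i y≤hZ (trans (sym (condA s Z i above)) (>>≡0-mono (h s) k≤i hs>>k≡0)))
  ...   | inj₂ i≤k = s-aligned (y ⊕ Z) (subst (s >> k ≤_) (sym y⊕Zₖ≡Zₖ) (>>-mono-≤ k s≤Z))
    where
    y⊕Zₖ≡Zₖ : (y ⊕ Z) >> k ≡ Z >> k
    y⊕Zₖ≡Zₖ = >>-⊕-small k Z
      (>>≡0-anti k y≤hZ (trans (sym (>>-agree-≤ (h s) (h Z) i≤k (condA s Z i above))) hs>>k≡0))

  ⊕∸s-injective : ∀ {x W x′ W′} → x ≤ h W → s ≤ W → x′ ≤ h W′ → s ≤ W′ →
                  (x ⊕ W) ∸ s ≡ (x′ ⊕ W′) ∸ s → x ⊕ W ≡ x′ ⊕ W′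
  ⊕∸s-injective x≤hW s≤W x′≤hW′ s≤W′ = ∸-cancelʳ-≡ (s≤⊕ x≤hW s≤W) (s≤⊕ x′≤hW′ s≤W′)

  s≤⊕⇒s≤ : ∀ {x W} → x ≤ h W → s ≤ x ⊕ W → s ≤ W
  s≤⊕⇒s≤ {x} {W} x≤hW s≤x⊕W with ≤-total s W
  ... | inj₁ s≤W = s≤W
  ... | inj₂ W≤s = s-aligned W (subst (s >> k ≤_) x⊕Wₖ≡Wₖ (>>-mono-≤ k s≤x⊕W))
    where
    x⊕Wₖ≡Wₖ : (x ⊕ W) >> k ≡ W >> k
    x⊕Wₖ≡Wₖ = >>-⊕-small k W (>>≡0-anti k (≤-trans x≤hW (nondecreasing W s W≤s)) hs>>k≡0)

  reachable : ∀ {y Z K} → y ≤ h Z → s ≤ K → K < y ⊕ Z →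
              (∃[ v ] v < y × v ⊕ Z ≡ K) ⊎ (∃[ W ] s ≤ W × W < Z × (y ⊓ h W) ⊕ W ≡ K)
  reachable {y} {Z} {K} y≤hZ s≤K K<y⊕Z with i , above , Kᵢ≡0 , y⊕Zᵢ≡1 ← <⇒<[] K<y⊕Z
    with +≡1ℙ-cases (trans (sym (parity>>-⊕ i y Z)) y⊕Zᵢ≡1)
  ... | inj₁ (yᵢ≡1 , Zᵢ≡0) = inj₁ (K ⊕ Z , <[]⇒< i (K⊕Z<[i]y) , [x⊕y]⊕y≡x K Z)
    where
    K⊕Z<[i]y : K ⊕ Z <[ i ] y
    K⊕Z<[i]y = above′ , trans (parity>>-⊕ i K Z) (cong₂ ℙ._+_ Kᵢ≡0 Zᵢ≡0) , yᵢ≡1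
      where
      open ≡-Reasoning
      above′ : (K ⊕ Z) >> suc i ≡ y >> suc i
      above′ = begin
        (K ⊕ Z) >> suc i                         ≡⟨ >>-distrib-⊕ (suc i) K Z ⟩
        K >> suc i ⊕ Z >> suc i                  ≡⟨ cong (_⊕ Z >> suc i) (trans above (>>-distrib-⊕ (suc i) y Z)) ⟩
        (y >> suc i ⊕ Z >> suc i) ⊕ Z >> suc i   ≡⟨ [x⊕y]⊕y≡x (y >> suc i) (Z >> suc i) ⟩
        y >> suc i                               ∎
  ... | inj₂ (yᵢ≡0 , Zᵢ≡1) =
    inj₂ (column (⊕-blockSurjective (⊓-conditionA>> y condA) i constant K K>>i≡yᵢ⊕P))
    where
    P : ℕ
    P = (K ⊕ y) >> i
    inBlock⇒above : ∀ {W} → W >> i ≡ P → W >> suc i ≡ Z >> suc i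
    inBlock⇒above {W} W>>i≡P = begin
      W >> suc i                               ≡⟨ cong ⌊_/2⌋ W>>i≡P ⟩
      (K ⊕ y) >> suc i                         ≡⟨ >>-distrib-⊕ (suc i) K y ⟩
      K >> suc i ⊕ y >> suc i                  ≡⟨ cong (_⊕ y >> suc i) (trans above (>>-distrib-⊕ (suc i) y Z)) ⟩
      (y >> suc i ⊕ Z >> suc i) ⊕ y >> suc i   ≡⟨ [x⊕y]⊕x≡y (y >> suc i) (Z >> suc i) ⟩
      Z >> suc i                               ∎
      where open ≡-Reasoning
    constant : ∀ W → W >> i ≡ P → (y ⊓ h W) >> i ≡ y >> i
    constant W W>>i≡P = trans (>>-distrib-⊓ i y (h W))
      (m≤n⇒m⊓n≡m (subst (y >> i ≤_) (sym (condA W Z i (inBlock⇒above W>>i≡P))) (>>-mono-≤ i y≤hZ)))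
    K>>i≡yᵢ⊕P : K >> i ≡ y >> i ⊕ P
    K>>i≡yᵢ⊕P = sym (trans (cong (y >> i ⊕_) (>>-distrib-⊕ i K y)) (x⊕[y⊕x]≡y (y >> i) (K >> i)))
    column : ∃[ W ] W >> i ≡ P × (y ⊓ h W) ⊕ W ≡ K → ∃[ W ] s ≤ W × W < Z × (y ⊓ h W) ⊕ W ≡ K
    column (W , W>>i≡P , value) =
      W , s≤⊕⇒s≤ (m⊓n≤n y (h W)) (subst (s ≤_) (sym value) s≤K) ,
      <[]⇒< i (inBlock⇒above W>>i≡P , Wᵢ≡0 , Zᵢ≡1) , value
      where
      Wᵢ≡0 : parity (W >> i) ≡ 0ℙ
      Wᵢ≡0 = trans (cong parity W>>i≡P) (trans (parity>>-⊕ i K y) (cong₂ ℙ._+_ Kᵢ≡0 yᵢ≡0))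

  isGrundyLabelling : IsGrundyLabelling (λ w → h (w + s)) (λ y z → (y ⊕ (z + s)) ∸ s)
  isGrundyLabelling = record
    { bounded  = λ {y} {z} _ → bounded y z
    ; realizes = realizes
    ; lower-≢  = λ {y} {z} {v} y≤h[z+s] v<y eq → <⇒≢ v<y (⊕-cancelʳ-≡ (z + s)
        (⊕∸s-injective (≤-trans (<⇒≤ v<y) y≤h[z+s]) (m≤n+m s z) y≤h[z+s] (m≤n+m s z) eq))
    ; left-≢   = λ {y} {z} {w} y≤h[z+s] w<z eq → ⊕-option-≢ condA y≤h[z+s] (+-monoˡ-< s w<z)
        (⊕∸s-injective (m⊓n≤n y (h (w + s))) (m≤n+m s w) y≤h[z+s] (m≤n+m s z) eq)
    }
    where
    bounded : ∀ y z → (y ⊕ (z + s)) ∸ s ≤ y + z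
    bounded y z = begin
      (y ⊕ (z + s)) ∸ s  ≤⟨ ∸-monoˡ-≤ s (⊕≤+ y (z + s)) ⟩
      (y + (z + s)) ∸ s  ≡⟨ cong (_∸ s) (+-assoc y z s) ⟨
      (y + z + s) ∸ s    ≡⟨ m+n∸n≡m (y + z) s ⟩
      y + z              ∎
      where open ≤-Reasoning
    realizes : ∀ {y z j} → y ≤ h (z + s) → j < (y ⊕ (z + s)) ∸ s →
               (∃[ v ] v < y × (v ⊕ (z + s)) ∸ s ≡ j) ⊎
               (∃[ w ] w < z × ((y ⊓ h (w + s)) ⊕ (w + s)) ∸ s ≡ j)
    realizes {y} {z} {j} y≤h[z+s] j<φ with reachable y≤h[z+s] (m≤n+m s j) j+s<y⊕Z
      where
      j+s<y⊕Z : j + s < y ⊕ (z + s)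
      j+s<y⊕Z = subst (j + s <_) (m∸n+n≡m (s≤⊕ y≤h[z+s] (m≤n+m s z))) (+-monoˡ-< s j<φ)
    ... | inj₁ (v , v<y , v⊕Z≡j+s) = inj₁ (v , v<y , trans (cong (_∸ s) v⊕Z≡j+s) (m+n∸n≡m j s))
    ... | inj₂ (W , s≤W , W<Z , value) = inj₂ (W ∸ s , w<z , value′)
      where
      W∸s+s≡W : W ∸ s + s ≡ W
      W∸s+s≡W = m∸n+n≡m s≤W
      w<z : W ∸ s < z
      w<z = +-cancelʳ-< s (W ∸ s) z (subst (_< z + s) (sym W∸s+s≡W) W<Z)
      value′ : ((y ⊓ h (W ∸ s + s)) ⊕ (W ∸ s + s)) ∸ s ≡ j
      value′ = trans (cong (λ W → ((y ⊓ h W) ⊕ W) ∸ s) W∸s+s≡W) (trans (cong (_∸ s) value) (m+n∸n≡m j s))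

mainTheorem4 : (h : ℕ → ℕ) → Nondecreasing h → ConditionA h →
    (s : ℕ) → 1 ≤ s → (∀ i → i ≤ h s → i ⊕ s ≡ i + s) →
    ∀ y z → y ≤ h (z + s) →
    G (λ w → h (w + s)) y z ≡ (y ⊕ (z + s)) ∸ s
mainTheorem4 h nondecreasing condA s 1≤s noCarry y z y≤h[z+s]
  with k , s-aligned , sₖ≡1 ← lowestSetBit s 1≤s =
  G≡ (isGrundyLabelling nondecreasing (conditionA⇒>> condA) {s} {k} s-aligned hs>>k≡0) y≤h[z+s]
  where
  hs>>k≡0 : h s >> k ≡ 0
  hs>>k≡0 = noCarry⇒>>≡0 {k} sₖ≡1 noCarry
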